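{- Let $w$ be a Sturmian word (equivalently, an irrational mechanical word) with slope $\alpha$. Then $\mathrm{PNF}_1(w)=1c_{\alpha}$ and $\mathrm{PNF}_0(w)=0c_{\alpha}$, where $c_\alpha$ is the characteristic word of slope $\alpha$.
   Context: Binary words are indexed from $1$. An infinite binary word is Sturmian if it is balanced (any two factors of equal length differ in number of $1$s by at most $1$) and not ultimately periodic; its slope $\alpha=\lim_{i\to\infty}P_w(i)/i$ exists and is irrational, where $P_w(i)$ is the number of $1$s in the prefix of length $i$. For irrational $\alpha\in(0,1)$, $c_\alpha(n)=\lfloor\alpha(n+1)\rfloor-\lfloor\alpha n\rfloor$ for $n\ge1$. $F^1_w(i)$ (resp. $F^0_w(i)$) is the maximum number of $1$s (resp. $0$s) in a factor of $w$ of length $i$, with $F^a_w(0)=0$. The prefix normal forms are $\mathrm{PNF}_1(w)=w'$, $\mathrm{PNF}_0(w)=w''$ with $w'_n=F^1_w(n)-F^1_w(n-1)$ and $w''_n=1-(F^0_w(n)-F^0_w(n-1))$ for $n\ge1$. -}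

module Defs where

open import Data.Bool using (Bool; true; false)
open import Data.Nat using (ℕ; zero; suc; _+_; _≤_; _<_)
open import Data.Integer using (+_)
open import Data.Rational using (ℚ; _/_) renaming (_<_ to _<ℚ_)
open import Data.Product using (_×_; ∃; ∃-syntax)
open import Relation.Nullary using (¬_)
open import Relation.Binary.PropositionalEquality using (_≡_)

-- An infinite binary word.  Convention: the paper's letter w_n (n ≥ 1)
-- is  w (n - 1), i.e. the Agda function is 0-based.
Word : Set
Word = ℕ → Bool

bit : Bool → ℕ
bit true  = 1
bit false = 0

ones : Word → ℕ → ℕ → ℕ
ones w i zero    = 0
ones w i (suc n) = bit (w i) + ones w (suc i) n

zeros : Word → ℕ → ℕ → ℕ
zeros w i zero    = 0
zeros w i (suc n) = (1 Data.Nat.∸ bit (w i)) + zeros w (suc i) n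

P : Word → ℕ → ℕ
P w n = ones w 0 n

Balanced : Word → Set
Balanced w = ∀ i j n → ones w i n ≤ ones w j n + 1

UltimatelyPeriodic : Word → Set
UltimatelyPeriodic w = ∃[ p ] ∃[ N ] (0 < p × (∀ i → N ≤ i → w (i + p) ≡ w i))

Sturmian : Word → Set
Sturmian w = Balanced w × ¬ UltimatelyPeriodic w

-- A real number α is represented by its (strict) lower cut  L q  ⇔  q < α.
-- IsSlope w L : lim_{i→∞} P_w(i)/i = α, where L is the lower cut of α:
-- every q with q < α is eventually below P_w(i)/i and every q with
-- ¬(q < α) is eventually above it.  (For an irrational limit this pins
-- down L uniquely as {q | q < α}.)
IsSlope : Word → (ℚ → Set) → Set
IsSlope w L =
  ∀ q → (L q → ∃[ N ] (∀ i → N ≤ i → q <ℚ ((+ P w (suc i)) / suc i)))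
      × (¬ L q → ∃[ N ] (∀ i → N ≤ i → ((+ P w (suc i)) / suc i) <ℚ q))

-- IsFloor L j k : k = ⌊α (j+1)⌋ (argument shifted so the multiplier j+1 ≥ 1),
-- i.e. k/(j+1) < α and ¬ ((k+1)/(j+1) < α)   (α irrational, so no equality case)
IsFloor : (ℚ → Set) → ℕ → ℕ → Set
IsFloor L j k = L ((+ k) / suc j) × ¬ L ((+ suc k) / suc j)

IsF1 : Word → ℕ → ℕ → Set
IsF1 w n k = (∃[ i ] ones w i n ≡ k) × (∀ i → ones w i n ≤ k)

IsF0 : Word → ℕ → ℕ → Set
IsF0 w n k = (∃[ i ] zeros w i n ≡ k) × (∀ i → zeros w i n ≤ k)

module Submission where

-- For n ≥ 1 put x = ⌊αn⌋. Cutting a long prefix of length kn into k factors of length n and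
-- comparing with P(kn) ≈ αkn shows that not every factor of length n has at most x ones and not
-- every one has more than x. Balance then pins the counts of all factors of length n to
-- {x, x + 1}, both attained, so F¹(n) = x + 1 and F⁰(n) = n − x; since F⁰ grows by at most 1 at
-- each step, these give the letters of c_α. For n = 1, aperiodicity makes both letters occur.

open import Defs
open import Data.Nat using (ℕ; zero; suc; _∸_)
open import Data.Rational using (ℚ)
open import Data.Product using (_×_)
open import Relation.Binary.PropositionalEquality using (_≡_)

open import Data.Bool using (true; false)
open import Data.Nat using (_+_; _*_; _≤_; _<_; z≤n; s≤s)
open import Data.Nat.Properties
open import Data.Product using (_,_; proj₁; proj₂)
open import Data.Sum using (inj₁; inj₂)
open import Data.Empty using (⊥-elim)
open import Data.Integer using (+_)
open import Relation.Nullary using (¬_)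
open import Relation.Binary.PropositionalEquality using (refl; sym; trans; cong; cong₂; subst; subst₂)
import Data.Integer as ℤ
import Data.Integer.Properties as ℤ
import Data.Rational as ℚ
import Data.Rational.Properties as ℚ
import Data.Rational.Unnormalised as ℚᵘ
import Data.Rational.Unnormalised.Properties as ℚᵘ

/-<⇒*< : ∀ a b c d → (+ a) ℚ./ suc b ℚ.< (+ c) ℚ./ suc d → a * suc d < c * suc b
/-<⇒*< a b c d p = ℤ.drop‿+<+ (subst₂ ℤ._<_ (sym (ℤ.pos-* a (suc d))) (sym (ℤ.pos-* c (suc b)))
                                         (ℚᵘ.drop-*<* unnormalised))
  where
  unnormalised : ℚᵘ.mkℚᵘ (+ a) b ℚᵘ.< ℚᵘ.mkℚᵘ (+ c) d
  unnormalised = ℚᵘ.<-respˡ-≃ (ℚ.toℚᵘ-fromℚᵘ (ℚᵘ.mkℚᵘ (+ a) b))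
                   (ℚᵘ.<-respʳ-≃ (ℚ.toℚᵘ-fromℚᵘ (ℚᵘ.mkℚᵘ (+ c) d)) (ℚ.toℚᵘ-mono-< p))

-- The combinatorial trace of x = ⌊αn⌋ on the factors of length n.
record Straddles (w : Word) (n x : ℕ) : Set where
  field
    ¬all≤ : ¬ (∀ t → ones w t n ≤ x)
    ¬all> : ¬ (∀ t → x < ones w t n)

module _ (w : Word) where

  ones-+ : ∀ i m n → ones w i (m + n) ≡ ones w i m + ones w (m + i) n
  ones-+ i zero    n = refl
  ones-+ i (suc m) n rewrite ones-+ (suc i) m n | +-suc m i =
    sym (+-assoc (bit (w i)) (ones w (suc i) m) _)

  zeros+ones : ∀ i n → zeros w i n + ones w i n ≡ n
  zeros+ones i zero = refl
  zeros+ones i (suc n) with w i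
  ... | true  = trans (+-suc (zeros w (suc i) n) _) (cong suc (zeros+ones (suc i) n))
  ... | false = cong suc (zeros+ones (suc i) n)

  zeros-suc : ∀ i n → zeros w i (suc n) ≡ zeros w i n + (1 ∸ bit (w (n + i)))
  zeros-suc i zero    = +-comm (1 ∸ bit (w i)) 0
  zeros-suc i (suc n) rewrite zeros-suc (suc i) n | +-suc n i =
    sym (+-assoc (1 ∸ bit (w i)) (zeros w (suc i) n) _)

  zeros-≤-suc : ∀ i n → zeros w i n ≤ zeros w i (suc n)
  zeros-≤-suc i n rewrite zeros-suc i n = m≤m+n _ _

  zeros-suc-≤ : ∀ i n → zeros w i (suc n) ≤ suc (zeros w i n)
  zeros-suc-≤ i n rewrite zeros-suc i n | +-comm (zeros w i n) (1 ∸ bit (w (n + i))) =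
    +-monoˡ-≤ (zeros w i n) (m∸n≤m 1 (bit (w (n + i))))

  module _ {n c : ℕ} where

    ones-blocks-≤ : (∀ t → ones w t n ≤ c) → ∀ k i → ones w i (k * n) ≤ k * c
    ones-blocks-≤ all≤ zero    i = z≤n
    ones-blocks-≤ all≤ (suc k) i rewrite ones-+ i n (k * n) =
      +-mono-≤ (all≤ i) (ones-blocks-≤ all≤ k (n + i))

    ones-blocks-> : (∀ t → c < ones w t n) → ∀ k i → k * suc c ≤ ones w i (k * n)
    ones-blocks-> all> zero    i = z≤n
    ones-blocks-> all> (suc k) i rewrite ones-+ i n (k * n) =
      +-mono-≤ (all> i) (ones-blocks-> all> k (n + i))

  -- The prefix of length (N + 1)(j + 1) is far enough out and consists of N + 1 blocks of length j + 1.
  module _ {L : ℚ → Set} (slope : IsSlope w L) {j c : ℕ} where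

    private
      prefix-length-≥ : ∀ N → N ≤ j + N * suc j
      prefix-length-≥ N = ≤-trans (m≤m*n N (suc j)) (m≤n+m (N * suc j) j)

      *-rotate : ∀ N m → suc N * m * suc j ≡ m * (suc N * suc j)
      *-rotate N m = trans (cong (_* suc j) (*-comm (suc N) m)) (*-assoc m (suc N) (suc j))

    ¬all-ones≤ : L ((+ c) ℚ./ suc j) → ¬ (∀ t → ones w t (suc j) ≤ c)
    ¬all-ones≤ below all≤ with proj₁ (slope _) below
    ... | N , eventually = <-irrefl refl (<-≤-trans ratio blocks)
      where
      i = j + N * suc j
      ratio : c * suc i < P w (suc i) * suc j
      ratio = /-<⇒*< c j (P w (suc i)) i (eventually i (prefix-length-≥ N))
      blocks : P w (suc i) * suc j ≤ c * suc i
      blocks = subst (P w (suc i) * suc j ≤_) (*-rotate N c)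
                 (*-monoˡ-≤ (suc j) (ones-blocks-≤ {suc j} all≤ (suc N) 0))

    ¬all-ones> : ¬ L ((+ suc c) ℚ./ suc j) → ¬ (∀ t → c < ones w t (suc j))
    ¬all-ones> not-below all> with proj₂ (slope _) not-below
    ... | N , eventually = <-irrefl refl (<-≤-trans ratio blocks)
      where
      i = j + N * suc j
      ratio : P w (suc i) * suc j < suc c * suc i
      ratio = /-<⇒*< (P w (suc i)) i (suc c) j (eventually i (prefix-length-≥ N))
      blocks : suc c * suc i ≤ P w (suc i) * suc j
      blocks = subst (_≤ P w (suc i) * suc j) (*-rotate N (suc c))
                 (*-monoˡ-≤ (suc j) (ones-blocks-> {suc j} all> (suc N) 0))

  floor⇒straddles : ∀ {L} → IsSlope w L → ∀ {j x} → IsFloor L j x → Straddles w (suc j) x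
  floor⇒straddles slope (below , not-below) = record
    { ¬all≤ = ¬all-ones≤ slope below ; ¬all> = ¬all-ones> slope not-below }

  module _ (balanced : Balanced w) {n x : ℕ} (straddles : Straddles w n x) where
    open Straddles straddles

    F1-value : ∀ {a} → IsF1 w n a → a ≡ suc x
    F1-value ((i , refl) , max) = ≤-antisym upper lower
      where
      lower : x < ones w i n
      lower = ≰⇒> (λ a≤x → ¬all≤ (λ t → ≤-trans (max t) a≤x))
      upper : ones w i n ≤ suc x
      upper = ≮⇒≥ λ x+1<a → ¬all> λ t →
        ≤-pred (≤-trans x+1<a (subst (ones w i n ≤_) (+-comm (ones w t n) 1) (balanced i t n)))

    F0-value : ∀ {b} → IsF0 w n b → b + x ≡ n
    F0-value ((i , refl) , max) =
      trans (cong (λ m → zeros w i n + m) (sym (≤-antisym upper lower))) (zeros+ones i n)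
      where
      minimal : ∀ t → ones w i n ≤ ones w t n
      minimal t = +-cancelˡ-≤ (zeros w t n) (ones w i n) (ones w t n) (begin
        zeros w t n + ones w i n  ≤⟨ +-monoˡ-≤ (ones w i n) (max t) ⟩
        zeros w i n + ones w i n  ≡⟨ zeros+ones i n ⟩
        n                         ≡⟨ zeros+ones t n ⟨
        zeros w t n + ones w t n  ∎)
        where open ≤-Reasoning
      upper : ones w i n ≤ x
      upper = ≮⇒≥ λ x<m → ¬all> λ t → <-≤-trans x<m (minimal t)
      lower : x ≤ ones w i n
      lower = ≮⇒≥ λ m<x → ¬all≤ λ t →
        ≤-trans (subst (ones w t n ≤_) (+-comm (ones w i n) 1) (balanced t i n)) m<x

  F0-suc-bounds : ∀ n {a b} → IsF0 w n a → IsF0 w (suc n) b → a ≤ b × b ≤ suc a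
  F0-suc-bounds n ((i , refl) , max) ((i′ , refl) , max′) =
    ≤-trans (zeros-≤-suc i n) (max′ i) , ≤-trans (zeros-suc-≤ i′ n) (s≤s (max i′))

  constant⇒ultimatelyPeriodic : ∀ {c} → (∀ i → w i ≡ c) → UltimatelyPeriodic w
  constant⇒ultimatelyPeriodic const = 1 , 0 , s≤s z≤n , λ i _ → trans (const (i + 1)) (sym (const i))

  module _ (aperiodic : ¬ UltimatelyPeriodic w) where

    F1[1]≡1 : ∀ {b} → IsF1 w 1 b → b ≡ 1
    F1[1]≡1 ((i , refl) , max) with w i
    ... | true  = refl
    ... | false = ⊥-elim (aperiodic (constant⇒ultimatelyPeriodic (λ t → only-0s (w t) (max t))))
      where
      only-0s : ∀ c → bit c + 0 ≤ 0 → c ≡ false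
      only-0s false _ = refl

    F0[1]≡1 : ∀ {b} → IsF0 w 1 b → b ≡ 1
    F0[1]≡1 ((i , refl) , max) with w i
    ... | false = refl
    ... | true  = ⊥-elim (aperiodic (constant⇒ultimatelyPeriodic (λ t → only-1s (w t) (max t))))
      where
      only-1s : ∀ c → (1 ∸ bit c) + 0 ≤ 0 → c ≡ true
      only-1s true _ = refl

1∸[b∸a]≡y∸x : ∀ {a b x y} → a ≤ b → b ≤ suc a → suc (a + x) ≡ b + y → 1 ∸ (b ∸ a) ≡ y ∸ x
1∸[b∸a]≡y∸x {a} {b} {x} {y} a≤b b≤1+a eq with m≤n⇒m<n∨m≡n b≤1+a
... | inj₂ refl rewrite +-cancelˡ-≡ a x y (suc-injective eq) | m+n∸n≡m 1 a | n∸n≡0 y = refl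
... | inj₁ (s≤s b≤a) rewrite ≤-antisym b≤a a≤b | +-cancelˡ-≡ a y (suc x) (trans (sym eq) (sym (+-suc a x)))
                           | n∸n≡0 a | m+n∸n≡m 1 x = refl

theorem5 : (w : Word) (L : ℚ → Set) → Sturmian w → IsSlope w L →
    (∀ a b → IsF1 w 0 a → IsF1 w 1 b → b ∸ a ≡ 1)
    × (∀ j a b x y → IsF1 w (suc j) a → IsF1 w (suc (suc j)) b →
         IsFloor L j x → IsFloor L (suc j) y → b ∸ a ≡ y ∸ x)
    × (∀ a b → IsF0 w 0 a → IsF0 w 1 b → 1 ∸ (b ∸ a) ≡ 0)
    × (∀ j a b x y → IsF0 w (suc j) a → IsF0 w (suc (suc j)) b →
         IsFloor L j x → IsFloor L (suc j) y → 1 ∸ (b ∸ a) ≡ y ∸ x)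
theorem5 w L (balanced , aperiodic) slope =
    (λ { a b ((_ , refl) , _) F¹₁ → F1[1]≡1 w aperiodic F¹₁ })
  , (λ j a b x y F¹a F¹b ⌊x⌋ ⌊y⌋ →
       cong₂ _∸_ (F1-value w balanced (straddles (suc j) y ⌊y⌋) F¹b)
                 (F1-value w balanced (straddles j x ⌊x⌋) F¹a))
  , (λ { a b ((_ , refl) , _) F⁰₁ → cong (1 ∸_) (F0[1]≡1 w aperiodic F⁰₁) })
  , λ j a b x y F⁰a F⁰b ⌊x⌋ ⌊y⌋ →
       let a≤b , b≤1+a = F0-suc-bounds w (suc j) F⁰a F⁰b
       in 1∸[b∸a]≡y∸x a≤b b≤1+a
            (trans (cong suc (F0-value w balanced (straddles j x ⌊x⌋) F⁰a))
                   (sym (F0-value w balanced (straddles (suc j) y ⌊y⌋) F⁰b)))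
  where
  straddles : ∀ j x → IsFloor L j x → Straddles w (suc j) x
  straddles j x = floor⇒straddles w slope
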